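{- (i) For every $d\in\mathbb{N}$, $\operatorname{cr_s}(d)=d$. (ii) $\operatorname{cr_h}(1)=0$ and $\operatorname{cr_h}(d)=d$ for every $d\ge 2$.
   Context: A lattice simplex in $\mathbb{R}^d$ is the convex hull of $d+1$ affinely independent points of $\mathbb{Z}^d$; it is hollow if its interior contains no point of $\mathbb{Z}^d$. After translating by a lattice vector so that a vertex is at the origin, write $\Delta=AS_d$ with $S_d=\operatorname{conv}\{\mathbf{0},e_1,\ldots,e_d\}$ and $A\in\mathbb{Z}^{d\times d}$ invertible with columns the nonzero vertices; the quotient group is $G_\Delta=\mathbb{Z}^d/A\mathbb{Z}^d$. The cyclicity rank $\operatorname{cr}(\Delta)$ is the number of elementary divisors (Smith normal form diagonal entries) of $A$ that are larger than $1$, i.e. the minimal number of cyclic groups of which $G_\Delta$ is a direct product. $\operatorname{cr_s}(d)$ is the maximum of $\operatorname{cr}(\Delta)$ over all lattice simplices $\Delta\subseteq\mathbb{R}^d$, and $\operatorname{cr_h}(d)$ is the maximum over all hollow lattice simplices $\Delta\subseteq\mathbb{R}^d$. -}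

module Defs where

open import Data.Nat as ℕ using (ℕ; zero; suc; _≤_; _<_)
open import Data.Nat.Divisibility using (_∣_)
open import Data.Integer as ℤ using (ℤ)
open import Data.Rational as ℚ using (ℚ)
open import Data.Fin using (Fin; toℕ) renaming (zero to fzero; suc to fsuc)
open import Data.Fin.Properties using () renaming (_≟_ to _≟ᶠ_)
open import Data.Product using (Σ; ∃; _×_)
open import Data.Unit using (⊤)
open import Relation.Nullary using (¬_; does)
open import Relation.Binary.PropositionalEquality using (_≡_)
open import Data.Bool using (if_then_else_)

-- d×d matrices as functions; vectors as functions
-- (matrix equalities are stated pointwise, no funext needed)
Mat : Set → ℕ → Set
Mat R d = Fin d → Fin d → R

sumℤ : ∀ {d} → (Fin d → ℤ) → ℤ
sumℤ {zero}  f = ℤ.0ℤ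
sumℤ {suc d} f = f fzero ℤ.+ sumℤ (λ i → f (fsuc i))

sumℚ : ∀ {d} → (Fin d → ℚ) → ℚ
sumℚ {zero}  f = ℚ.0ℚ
sumℚ {suc d} f = f fzero ℚ.+ sumℚ (λ i → f (fsuc i))

countGt1 : ∀ {d} → (Fin d → ℕ) → ℕ
countGt1 {zero}  s = zero
countGt1 {suc d} s =
  (if does (2 ℕ.≤? s fzero) then 1 else 0) ℕ.+ countGt1 (λ i → s (fsuc i))

_*ℤ_ : ∀ {d} → Mat ℤ d → Mat ℤ d → Mat ℤ d
(A *ℤ B) i j = sumℤ (λ k → A i k ℤ.* B k j)

_*ℚ_ : ∀ {d} → Mat ℚ d → Mat ℚ d → Mat ℚ d
(A *ℚ B) i j = sumℚ (λ k → A i k ℚ.* B k j)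

toℚ : ℤ → ℚ
toℚ z = z ℚ./ 1

idℤ : ∀ {d} → Mat ℤ d
idℤ i j = if does (i ≟ᶠ j) then ℤ.1ℤ else ℤ.0ℤ

idℚ : ∀ {d} → Mat ℚ d
idℚ i j = if does (i ≟ᶠ j) then ℚ.1ℚ else ℚ.0ℚ

diagℤ : ∀ {d} → (Fin d → ℕ) → Mat ℤ d
diagℤ s i j = if does (i ≟ᶠ j) then ℤ.+ (s i) else ℤ.0ℤ

-- A is invertible over ℝ (equivalently over ℚ, since A is integral)
Invertible : ∀ {d} → Mat ℤ d → Set
Invertible {d} A =
  Σ (Mat ℚ d) λ B → (∀ i j → ((λ i j → toℚ (A i j)) *ℚ B) i j ≡ idℚ i j)
  × (∀ i j → (B *ℚ (λ i j → toℚ (A i j))) i j ≡ idℚ i j)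

Unimodular : ∀ {d} → Mat ℤ d → Set
Unimodular {d} U = Σ (Mat ℤ d) λ W → (∀ i j → (U *ℤ W) i j ≡ idℤ i j) × (∀ i j → (W *ℤ U) i j ≡ idℤ i j)

IsSmithDiagonal : ∀ {d} → Mat ℤ d → (Fin d → ℕ) → Set
IsSmithDiagonal {d} A s =
  Σ (Mat ℤ d) λ U → Σ (Mat ℤ d) λ V →
    Unimodular U × Unimodular V × (∀ i j → ((U *ℤ A) *ℤ V) i j ≡ diagℤ s i j)
    × (∀ (i j : Fin d) → toℕ i ≤ toℕ j → s i ∣ s j)

-- cr(Δ) = r for Δ = A S_d: number of elementary divisors of A larger than 1
HasCr : ∀ {d} → Mat ℤ d → ℕ → Set
HasCr {d} A r = Σ (Fin d → ℕ) λ s → IsSmithDiagonal A s × (countGt1 s ≡ r)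

-- Δ = A S_d is hollow: no lattice point z = A λ with all λᵢ > 0 and Σ λᵢ < 1
-- (λ is necessarily rational since A is invertible and z integral)
Hollow : ∀ {d} → Mat ℤ d → Set
Hollow {d} A =
  ¬ (Σ (Fin d → ℤ) λ z → Σ (Fin d → ℚ) λ l →
      (∀ i → ℚ.0ℚ ℚ.< l i) × (sumℚ l ℚ.< ℚ.1ℚ)
      × (∀ i → sumℚ (λ j → toℚ (A i j) ℚ.* l j) ≡ toℚ (z i)))

AnySimplex : ∀ {d} → Mat ℤ d → Set
AnySimplex _ = ⊤

IsMaxCr : (P : ∀ {d} → Mat ℤ d → Set) → ℕ → ℕ → Set
IsMaxCr P d r =
  (Σ (Mat ℤ d) λ A → Invertible A × P A × HasCr A r)
  × (∀ (A : Mat ℤ d) → Invertible A → P A → ∀ r' → HasCr A r' → r' ≤ r)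

-- The Smith diagonal has d entries, so cr ≤ d, and the scalar matrix 2·I has d elementary
-- divisors equal to 2. The simplex c·S_d is hollow whenever 1 ≤ c ≤ d: at a lattice point c·λ
-- every cλᵢ is a positive integer, so c·Σλᵢ ≥ d ≥ c. In dimension one, u a v = s with u, v units
-- forces s ∣ a, and for s ≥ 2 the lattice point a/s lies in the interior of [0, a].
module Submission where

open import Defs
open import Data.Nat as ℕ using (ℕ; zero; suc; _≤_; z≤n; s≤s)
open import Data.Nat.Divisibility using (_∣_; ∣-refl)
import Data.Nat.Properties as ℕP
open import Data.Nat.Coprimality using (1-coprimeTo) renaming (sym to coprime-sym)
open import Data.Integer as ℤ using (ℤ; +_; -[1+_])
import Data.Integer.Properties as ℤP
open import Data.Integer.Tactic.RingSolver using (solve-∀)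
open import Data.Rational as ℚ using (ℚ; mkℚ; toℚᵘ; *≤*; *<*)
import Data.Rational.Properties as ℚP
open import Data.Rational.Unnormalised as ℚᵘ using (mkℚᵘ; *≡*)
import Data.Rational.Unnormalised.Properties as ℚᵘP
open import Data.Fin using (Fin; toℕ) renaming (zero to fzero; suc to fsuc)
open import Data.Fin.Properties using (suc-injective) renaming (_≟_ to _≟ᶠ_)
open import Data.Product using (Σ; _×_; _,_)
open import Data.Unit using (tt)
open import Data.Bool using (true; false; if_then_else_)
open import Relation.Nullary using (¬_; does; yes; no; contradiction)
open import Relation.Nullary.Decidable using (dec-true; dec-false)
open import Relation.Binary.PropositionalEquality

private
  variable
    d : ℕ

if-≟-refl : ∀ {A : Set} (i : Fin d) (x y : A) → (if does (i ≟ᶠ i) then x else y) ≡ x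
if-≟-refl i x y = cong (if_then x else y) (dec-true (i ≟ᶠ i) refl)

if-≟-≢ : ∀ {A : Set} {i j : Fin d} (x y : A) → ¬ i ≡ j → (if does (i ≟ᶠ j) then x else y) ≡ y
if-≟-≢ {i = i} {j} x y i≢j = cong (if_then x else y) (dec-false (i ≟ᶠ j) i≢j)

sumℤ-zero : (f : Fin d → ℤ) → (∀ k → f k ≡ ℤ.0ℤ) → sumℤ f ≡ ℤ.0ℤ
sumℤ-zero {zero}  f f≡0 = refl
sumℤ-zero {suc d} f f≡0 = cong₂ ℤ._+_ (f≡0 fzero) (sumℤ-zero (λ k → f (fsuc k)) (λ k → f≡0 (fsuc k)))

sumℤ-single : (i : Fin d) (f : Fin d → ℤ) → (∀ k → ¬ k ≡ i → f k ≡ ℤ.0ℤ) → sumℤ f ≡ f i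
sumℤ-single {suc d} fzero f f≡0
  rewrite sumℤ-zero (λ k → f (fsuc k)) (λ k → f≡0 (fsuc k) λ ()) = ℤP.+-identityʳ (f fzero)
sumℤ-single {suc d} (fsuc i) f f≡0 rewrite f≡0 fzero (λ ()) =
  trans (ℤP.+-identityˡ _)
        (sumℤ-single i (λ k → f (fsuc k)) (λ k k≢i → f≡0 (fsuc k) (λ e → k≢i (suc-injective e))))

sumℚ-zero : (f : Fin d → ℚ) → (∀ k → f k ≡ ℚ.0ℚ) → sumℚ f ≡ ℚ.0ℚ
sumℚ-zero {zero}  f f≡0 = refl
sumℚ-zero {suc d} f f≡0 = cong₂ ℚ._+_ (f≡0 fzero) (sumℚ-zero (λ k → f (fsuc k)) (λ k → f≡0 (fsuc k)))

sumℚ-single : (i : Fin d) (f : Fin d → ℚ) → (∀ k → ¬ k ≡ i → f k ≡ ℚ.0ℚ) → sumℚ f ≡ f i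
sumℚ-single {suc d} fzero f f≡0
  rewrite sumℚ-zero (λ k → f (fsuc k)) (λ k → f≡0 (fsuc k) λ ()) = ℚP.+-identityʳ (f fzero)
sumℚ-single {suc d} (fsuc i) f f≡0 rewrite f≡0 fzero (λ ()) =
  trans (ℚP.+-identityˡ _)
        (sumℚ-single i (λ k → f (fsuc k)) (λ k k≢i → f≡0 (fsuc k) (λ e → k≢i (suc-injective e))))

mulℤ-diagonalˡ : (M N : Mat ℤ d) (i j : Fin d) → (∀ k → ¬ k ≡ i → M i k ≡ ℤ.0ℤ) →
                 (M *ℤ N) i j ≡ M i i ℤ.* N i j
mulℤ-diagonalˡ M N i j M≡0 =
  sumℤ-single i _ (λ k k≢i → trans (cong (ℤ._* N k j) (M≡0 k k≢i)) (ℤP.*-zeroˡ (N k j)))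

mulℤ-diagonalʳ : (M N : Mat ℤ d) (i j : Fin d) → (∀ k → ¬ k ≡ j → N k j ≡ ℤ.0ℤ) →
                 (M *ℤ N) i j ≡ M i j ℤ.* N j j
mulℤ-diagonalʳ M N i j N≡0 =
  sumℤ-single j _ (λ k k≢j → trans (cong (M i k ℤ.*_) (N≡0 k k≢j)) (ℤP.*-zeroʳ (M i k)))

mulℚ-diagonalʳ : (M N : Mat ℚ d) (i j : Fin d) → (∀ k → ¬ k ≡ j → N k j ≡ ℚ.0ℚ) →
                 (M *ℚ N) i j ≡ M i j ℚ.* N j j
mulℚ-diagonalʳ M N i j N≡0 =
  sumℚ-single j _ (λ k k≢j → trans (cong (M i k ℚ.*_) (N≡0 k k≢j)) (ℚP.*-zeroʳ (M i k)))

idℤ-identityˡ : (N : Mat ℤ d) (i j : Fin d) → (idℤ *ℤ N) i j ≡ N i j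
idℤ-identityˡ N i j = begin
  (idℤ *ℤ N) i j       ≡⟨ mulℤ-diagonalˡ idℤ N i j (λ k k≢i → if-≟-≢ _ _ (≢-sym k≢i)) ⟩
  idℤ i i ℤ.* N i j    ≡⟨ cong (ℤ._* N i j) (if-≟-refl i _ _) ⟩
  ℤ.1ℤ ℤ.* N i j       ≡⟨ ℤP.*-identityˡ (N i j) ⟩
  N i j                ∎
  where open ≡-Reasoning

idℤ-identityʳ : (N : Mat ℤ d) (i j : Fin d) → (N *ℤ idℤ) i j ≡ N i j
idℤ-identityʳ N i j = begin
  (N *ℤ idℤ) i j       ≡⟨ mulℤ-diagonalʳ N idℤ i j (λ k k≢j → if-≟-≢ _ _ k≢j) ⟩
  N i j ℤ.* idℤ j j    ≡⟨ cong (N i j ℤ.*_) (if-≟-refl j _ _) ⟩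
  N i j ℤ.* ℤ.1ℤ       ≡⟨ ℤP.*-identityʳ (N i j) ⟩
  N i j                ∎
  where open ≡-Reasoning

idℤ-unimodular : Unimodular (idℤ {d})
idℤ-unimodular = idℤ , idℤ-identityˡ idℤ , idℤ-identityˡ idℤ

diagℤ-isSmithDiagonal : (s : Fin d → ℕ) → (∀ (i j : Fin d) → toℕ i ≤ toℕ j → s i ∣ s j) →
                        IsSmithDiagonal (diagℤ s) s
diagℤ-isSmithDiagonal s s-chain =
  idℤ , idℤ , idℤ-unimodular , idℤ-unimodular ,
  (λ i j → trans (idℤ-identityʳ (idℤ *ℤ diagℤ s) i j) (idℤ-identityˡ (diagℤ s) i j)) ,
  s-chain

diagℤ-invertible : (s : Fin d → ℕ) (q : Fin d → ℚ) → (∀ i → toℚ (+ s i) ℚ.* q i ≡ ℚ.1ℚ) →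
                   Invertible (diagℤ s)
diagℤ-invertible {d} s q inverse = B , D*B≡I , B*D≡I
  where
  B : Mat ℚ d
  B i j = if does (i ≟ᶠ j) then q i else ℚ.0ℚ
  D : Mat ℚ d
  D i j = toℚ (diagℤ s i j)

  D*B≡I : ∀ i j → (D *ℚ B) i j ≡ idℚ i j
  D*B≡I i j rewrite mulℚ-diagonalʳ D B i j (λ k → if-≟-≢ (q k) ℚ.0ℚ)
                  | if-≟-refl j (q j) ℚ.0ℚ with i ≟ᶠ j
  ... | yes refl = inverse i
  ... | no _     = ℚP.*-zeroˡ (q j)

  B*D≡I : ∀ i j → (B *ℚ D) i j ≡ idℚ i j
  B*D≡I i j rewrite mulℚ-diagonalʳ B D i j (λ k k≢j → cong toℚ (if-≟-≢ (+ s k) ℤ.0ℤ k≢j))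
                  | if-≟-refl j (+ s j) ℤ.0ℤ with i ≟ᶠ j
  ... | yes refl = trans (ℚP.*-comm (q i) _) (inverse i)
  ... | no _     = ℚP.*-zeroˡ (toℚ (+ s j))

countGt1≤ : (s : Fin d → ℕ) → countGt1 s ≤ d
countGt1≤ {zero}  s = z≤n
countGt1≤ {suc d} s with does (2 ℕ.≤? s fzero)
... | true  = s≤s (countGt1≤ (λ i → s (fsuc i)))
... | false = ℕP.m≤n⇒m≤1+n (countGt1≤ (λ i → s (fsuc i)))

countGt1-all>1 : (s : Fin d → ℕ) → (∀ i → 2 ≤ s i) → countGt1 s ≡ d
countGt1-all>1 {zero}  s s>1 = refl
countGt1-all>1 {suc d} s s>1 rewrite dec-true (2 ℕ.≤? s fzero) (s>1 fzero) =
  cong suc (countGt1-all>1 (λ i → s (fsuc i)) (λ i → s>1 (fsuc i)))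

countGt1-all≤1 : (s : Fin d → ℕ) → (∀ i → ¬ 2 ≤ s i) → countGt1 s ≡ 0
countGt1-all≤1 {zero}  s s≤1 = refl
countGt1-all≤1 {suc d} s s≤1 rewrite dec-false (2 ℕ.≤? s fzero) (s≤1 fzero) =
  countGt1-all≤1 (λ i → s (fsuc i)) (λ i → s≤1 (fsuc i))

hasCr≤ : (A : Mat ℤ d) (r : ℕ) → HasCr A r → r ≤ d
hasCr≤ A r (s , _ , refl) = countGt1≤ s


toℚ-mkℚ : (z : ℤ) → toℚ z ≡ mkℚ z 0 (coprime-sym (1-coprimeTo ℤ.∣ z ∣))
toℚ-mkℚ z = ℚP.↥p/↧p≡p (mkℚ z 0 (coprime-sym (1-coprimeTo ℤ.∣ z ∣)))

toℚᵘ-toℚ : (z : ℤ) → toℚᵘ (toℚ z) ℚᵘ.≃ mkℚᵘ z 0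
toℚᵘ-toℚ z = ℚᵘP.≃-reflexive (cong toℚᵘ (toℚ-mkℚ z))

toℚ-+ : (x y : ℤ) → toℚ (x ℤ.+ y) ≡ toℚ x ℚ.+ toℚ y
toℚ-+ x y = ℚP.toℚᵘ-injective (begin
  toℚᵘ (toℚ (x ℤ.+ y))            ≈⟨ toℚᵘ-toℚ (x ℤ.+ y) ⟩
  mkℚᵘ (x ℤ.+ y) 0                ≈⟨ *≡* (ring x y) ⟩
  mkℚᵘ x 0 ℚᵘ.+ mkℚᵘ y 0          ≈⟨ ℚᵘP.+-cong (toℚᵘ-toℚ x) (toℚᵘ-toℚ y) ⟨
  toℚᵘ (toℚ x) ℚᵘ.+ toℚᵘ (toℚ y)  ≈⟨ ℚP.toℚᵘ-homo-+ (toℚ x) (toℚ y) ⟨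
  toℚᵘ (toℚ x ℚ.+ toℚ y)          ∎)
  where
  open ℚᵘP.≃-Reasoning
  ring : ∀ x y → (x ℤ.+ y) ℤ.* + 1 ≡ (x ℤ.* + 1 ℤ.+ y ℤ.* + 1) ℤ.* + 1
  ring = solve-∀

toℚ-positive⇒1≤ : (z : ℤ) → ℚ.0ℚ ℚ.< toℚ z → ℚ.1ℚ ℚ.≤ toℚ z
toℚ-positive⇒1≤ (+ zero)  0<0 = contradiction 0<0 (ℚP.<-irrefl refl)
toℚ-positive⇒1≤ (+ suc n) _ rewrite toℚ-mkℚ (+ suc n) = *≤* (ℤ.+≤+ (s≤s z≤n))
toℚ-positive⇒1≤ -[1+ n ] 0<z rewrite toℚ-mkℚ -[1+ n ] with 0<z
... | *<* ()

toℚ-suc-positive : (n : ℕ) → ℚ.Positive (toℚ (+ suc n))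
toℚ-suc-positive n =
  ℚ.positive (subst (ℚ.0ℚ ℚ.<_) (sym (toℚ-mkℚ (+ suc n))) (*<* (ℤ.+<+ (s≤s z≤n))))

sumℚ-*-distribˡ : (q : ℚ) (f : Fin d → ℚ) → sumℚ (λ i → q ℚ.* f i) ≡ q ℚ.* sumℚ f
sumℚ-*-distribˡ {zero}  q f = sym (ℚP.*-zeroʳ q)
sumℚ-*-distribˡ {suc d} q f = begin
  q ℚ.* f fzero ℚ.+ sumℚ (λ i → q ℚ.* f (fsuc i))  ≡⟨ cong (q ℚ.* f fzero ℚ.+_) (sumℚ-*-distribˡ q (λ i → f (fsuc i))) ⟩
  q ℚ.* f fzero ℚ.+ q ℚ.* sumℚ (λ i → f (fsuc i))  ≡⟨ ℚP.*-distribˡ-+ q (f fzero) _ ⟨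
  q ℚ.* sumℚ f                                      ∎
  where open ≡-Reasoning

sumℚ-nonNegative : (f : Fin d → ℚ) → (∀ i → ℚ.0ℚ ℚ.≤ f i) → ℚ.0ℚ ℚ.≤ sumℚ f
sumℚ-nonNegative {zero}  f f≥0 = ℚP.≤-refl
sumℚ-nonNegative {suc d} f f≥0 =
  ℚP.+-mono-≤ (f≥0 fzero) (sumℚ-nonNegative (λ i → f (fsuc i)) (λ i → f≥0 (fsuc i)))

toℚ-≤-sumℚ : {c : ℕ} (f : Fin d → ℚ) → c ≤ d → (∀ i → ℚ.1ℚ ℚ.≤ f i) → toℚ (+ c) ℚ.≤ sumℚ f
toℚ-≤-sumℚ f z≤n f≥1 = sumℚ-nonNegative f (λ i → ℚP.≤-trans (*≤* (ℤ.+≤+ z≤n)) (f≥1 i))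
toℚ-≤-sumℚ {suc d} {suc c} f (s≤s c≤d) f≥1 =
  subst (ℚ._≤ sumℚ f) (sym (toℚ-+ (+ 1) (+ c)))
        (ℚP.+-mono-≤ (f≥1 fzero) (toℚ-≤-sumℚ (λ i → f (fsuc i)) c≤d (λ i → f≥1 (fsuc i))))

diagℤ-apply : (s : Fin d → ℕ) (l : Fin d → ℚ) (i : Fin d) →
              sumℚ (λ j → toℚ (diagℤ s i j) ℚ.* l j) ≡ toℚ (+ s i) ℚ.* l i
diagℤ-apply s l i = begin
  sumℚ (λ j → toℚ (diagℤ s i j) ℚ.* l j) ≡⟨ sumℚ-single i _ off-diagonal ⟩
  toℚ (diagℤ s i i) ℚ.* l i              ≡⟨ cong (λ x → toℚ x ℚ.* l i) (if-≟-refl i _ _) ⟩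
  toℚ (+ s i) ℚ.* l i                    ∎
  where
  open ≡-Reasoning
  off-diagonal : ∀ k → ¬ k ≡ i → toℚ (diagℤ s i k) ℚ.* l k ≡ ℚ.0ℚ
  off-diagonal k k≢i =
    trans (cong (λ x → toℚ x ℚ.* l k) (if-≟-≢ _ _ (≢-sym k≢i))) (ℚP.*-zeroˡ (l k))

scalar-hollow : (c : ℕ) → 1 ≤ c → c ≤ d → Hollow (diagℤ {d} (λ _ → c))
scalar-hollow {d} (suc c) _ c≤d (z , l , l>0 , Σl<1 , Dl≡z) =
  ℚP.<-irrefl refl (ℚP.≤-<-trans γ≤γΣl γΣl<γ)
  where
  γ : ℚ
  γ = toℚ (+ suc c)
  instance
    γ-positive : ℚ.Positive γ
    γ-positive = toℚ-suc-positive c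

  γl≥1 : ∀ i → ℚ.1ℚ ℚ.≤ γ ℚ.* l i
  γl≥1 i = subst (ℚ.1ℚ ℚ.≤_) (sym γl≡z) (toℚ-positive⇒1≤ (z i) (subst (ℚ.0ℚ ℚ.<_) γl≡z γl>0))
    where
    γl≡z : γ ℚ.* l i ≡ toℚ (z i)
    γl≡z = trans (sym (diagℤ-apply _ l i)) (Dl≡z i)
    γl>0 : ℚ.0ℚ ℚ.< γ ℚ.* l i
    γl>0 = subst (ℚ._< γ ℚ.* l i) (ℚP.*-zeroʳ γ) (ℚP.*-monoʳ-<-pos γ (l>0 i))

  γ≤γΣl : γ ℚ.≤ γ ℚ.* sumℚ l
  γ≤γΣl = subst (γ ℚ.≤_) (sumℚ-*-distribˡ γ l) (toℚ-≤-sumℚ _ c≤d γl≥1)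

  γΣl<γ : γ ℚ.* sumℚ l ℚ.< γ
  γΣl<γ = subst (γ ℚ.* sumℚ l ℚ.<_) (ℚP.*-identityʳ γ) (ℚP.*-monoʳ-<-pos γ Σl<1)

1/[1+_] : ℕ → ℚ
1/[1+ m ] = mkℚ (+ 1) m (1-coprimeTo (suc m))

toℚ-*-1/[1+] : (k : ℤ) (m : ℕ) → toℚ (k ℤ.* + suc m) ℚ.* 1/[1+ m ] ≡ toℚ k
toℚ-*-1/[1+] k m = ℚP.toℚᵘ-injective (begin
  toℚᵘ (toℚ (k ℤ.* + suc m) ℚ.* 1/[1+ m ])       ≈⟨ ℚP.toℚᵘ-homo-* (toℚ (k ℤ.* + suc m)) 1/[1+ m ] ⟩
  toℚᵘ (toℚ (k ℤ.* + suc m)) ℚᵘ.* mkℚᵘ (+ 1) m  ≈⟨ ℚᵘP.*-congʳ (toℚᵘ-toℚ (k ℤ.* + suc m)) ⟩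
  mkℚᵘ (k ℤ.* + suc m) 0 ℚᵘ.* mkℚᵘ (+ 1) m      ≈⟨ *≡* cancel ⟩
  mkℚᵘ k 0                                      ≈⟨ toℚᵘ-toℚ k ⟨
  toℚᵘ (toℚ k)                                  ∎)
  where
  open ℚᵘP.≃-Reasoning
  cancel : (k ℤ.* + suc m) ℤ.* + 1 ℤ.* + 1 ≡ k ℤ.* + suc (m ℕ.+ 0)
  cancel rewrite ℕP.+-identityʳ m | ℤP.*-identityʳ (k ℤ.* + suc m) = ℤP.*-identityʳ (k ℤ.* + suc m)

*ℤ-1×1 : (M N : Mat ℤ 1) → (M *ℤ N) fzero fzero ≡ M fzero fzero ℤ.* N fzero fzero
*ℤ-1×1 M N = ℤP.+-identityʳ (M fzero fzero ℤ.* N fzero fzero)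

smith₁-divides : (A : Mat ℤ 1) (s : Fin 1 → ℕ) → IsSmithDiagonal A s →
                 Σ ℤ λ k → A fzero fzero ≡ k ℤ.* + s fzero
smith₁-divides A s (U , V , (W , U*W≡I , _) , (W′ , V*W′≡I , _) , UAV≡D , _) =
  w ℤ.* w′ , (begin
    a                                       ≡⟨ ℤP.*-identityˡ a ⟨
    ℤ.1ℤ ℤ.* a                              ≡⟨ cong (ℤ._* a) (cong₂ ℤ._*_ uw≡1 vw′≡1) ⟨
    ((u ℤ.* w) ℤ.* (v ℤ.* w′)) ℤ.* a        ≡⟨ regroup u w v w′ a ⟩
    (w ℤ.* w′) ℤ.* ((u ℤ.* a) ℤ.* v)        ≡⟨ cong ((w ℤ.* w′) ℤ.*_) uav≡s ⟩
    (w ℤ.* w′) ℤ.* + s fzero                ∎)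
  where
  open ≡-Reasoning
  a = A fzero fzero
  u = U fzero fzero
  v = V fzero fzero
  w = W fzero fzero
  w′ = W′ fzero fzero
  uw≡1 : u ℤ.* w ≡ ℤ.1ℤ
  uw≡1 = trans (sym (*ℤ-1×1 U W)) (U*W≡I fzero fzero)
  vw′≡1 : v ℤ.* w′ ≡ ℤ.1ℤ
  vw′≡1 = trans (sym (*ℤ-1×1 V W′)) (V*W′≡I fzero fzero)
  uav≡s : (u ℤ.* a) ℤ.* v ≡ + s fzero
  uav≡s = trans (sym (trans (*ℤ-1×1 (U *ℤ A) V) (cong (ℤ._* v) (*ℤ-1×1 U A)))) (UAV≡D fzero fzero)
  regroup : ∀ u w v w′ a → ((u ℤ.* w) ℤ.* (v ℤ.* w′)) ℤ.* a ≡ (w ℤ.* w′) ℤ.* ((u ℤ.* a) ℤ.* v)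
  regroup = solve-∀

divisible-¬hollow₁ : (A : Mat ℤ 1) (k : ℤ) (n : ℕ) → 2 ≤ n → A fzero fzero ≡ k ℤ.* + n → ¬ Hollow A
divisible-¬hollow₁ A k (suc (suc m)) (s≤s (s≤s z≤n)) a≡kn hollow =
  hollow ((λ _ → k) , (λ _ → λ₀) , (λ _ → *<* (ℤ.+<+ (s≤s z≤n))) , λ₀<1 , Aλ≡k)
  where
  λ₀ : ℚ
  λ₀ = 1/[1+ suc m ]
  λ₀<1 : λ₀ ℚ.+ ℚ.0ℚ ℚ.< ℚ.1ℚ
  λ₀<1 = subst (ℚ._< ℚ.1ℚ) (sym (ℚP.+-identityʳ λ₀)) (*<* (ℤ.+<+ (s≤s (s≤s z≤n))))
  Aλ≡k : ∀ i → toℚ (A i fzero) ℚ.* λ₀ ℚ.+ ℚ.0ℚ ≡ toℚ k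
  Aλ≡k fzero rewrite a≡kn = trans (ℚP.+-identityʳ _) (toℚ-*-1/[1+] k (suc m))

hollow₁-hasCr≤0 : (A : Mat ℤ 1) → Hollow A → (r : ℕ) → HasCr A r → r ≤ 0
hollow₁-hasCr≤0 A hollow r (s , smith , refl) = ℕP.≤-reflexive (countGt1-all≤1 s s≤1)
  where
  s≤1 : ∀ i → ¬ 2 ≤ s i
  s≤1 fzero s>1 with smith₁-divides A s smith
  ... | k , a≡ks = divisible-¬hollow₁ A k (s fzero) s>1 a≡ks hollow

scalar-invertible : (m : ℕ) → Invertible (diagℤ {d} (λ _ → suc m))
scalar-invertible m = diagℤ-invertible _ (λ _ → 1/[1+ m ]) (λ _ → inverse)
  where
  inverse : toℚ (+ suc m) ℚ.* 1/[1+ m ] ≡ ℚ.1ℚ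
  inverse = subst (λ x → toℚ x ℚ.* 1/[1+ m ] ≡ ℚ.1ℚ) (ℤP.*-identityˡ (+ suc m)) (toℚ-*-1/[1+] ℤ.1ℤ m)

scalar-isSmithDiagonal : (c : ℕ) → IsSmithDiagonal (diagℤ {d} (λ _ → c)) (λ _ → c)
scalar-isSmithDiagonal c = diagℤ-isSmithDiagonal _ (λ _ _ _ → ∣-refl)

scalar-hasCr : (c : ℕ) → 2 ≤ c → HasCr (diagℤ {d} (λ _ → c)) d
scalar-hasCr c c>1 = (λ _ → c) , scalar-isSmithDiagonal c , countGt1-all>1 _ (λ _ → c>1)

proposition2p6 : ((d : ℕ) → IsMaxCr AnySimplex d d)
    × IsMaxCr Hollow 1 0
    × ((d : ℕ) → 2 ≤ d → IsMaxCr Hollow d d)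
proposition2p6 = maxCr , maxCr-hollow₁ , maxCr-hollow
  where
  2≤2 : 2 ≤ 2
  2≤2 = s≤s (s≤s z≤n)

  maxCr : (d : ℕ) → IsMaxCr AnySimplex d d
  maxCr d = (diagℤ (λ _ → 2) , scalar-invertible 1 , tt , scalar-hasCr 2 2≤2) ,
            (λ A _ _ → hasCr≤ A)

  maxCr-hollow₁ : IsMaxCr Hollow 1 0
  maxCr-hollow₁ = (diagℤ (λ _ → 1) , scalar-invertible 0 , scalar-hollow 1 ℕP.≤-refl ℕP.≤-refl ,
                   ((λ _ → 1) , scalar-isSmithDiagonal 1 , refl)) ,
                  (λ A _ → hollow₁-hasCr≤0 A)

  maxCr-hollow : (d : ℕ) → 2 ≤ d → IsMaxCr Hollow d d
  maxCr-hollow d d≥2 =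
    (diagℤ (λ _ → 2) , scalar-invertible 1 , scalar-hollow 2 (s≤s z≤n) d≥2 , scalar-hasCr 2 2≤2) ,
    (λ A _ _ → hasCr≤ A)
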